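{- Let $S$ be a rooted tree with at most $n$ nodes whose root $r$ has $m$ children, ordered arbitrarily. Remove the children of the root (together with their subtrees) one by one from right to left, producing trees $S_1, S_2, \ldots, S_m$. For each $i$, let $z_i$ be the node of $S_i$ connected to $r$ by a heavy edge in $S_i$, or $z_i = r$ if $r$ has no incident heavy edge in $S_i$. Then the set $\{z_1, z_2, \ldots, z_m\}$ contains at most $\log_2 n$ distinct nodes.
   Context: In a rooted tree, $\mathrm{size}(w)$ is the number of nodes in the subtree rooted at $w$. An edge from a child $v$ to its parent $u$ is heavy if $\mathrm{size}(v) > \mathrm{size}(u)/2$, and light otherwise (so each node has at most one child joined to it by a heavy edge). -}

module Defs where

open import Data.Nat using (ℕ; zero; suc; _+_; _*_; _∸_; _<ᵇ_)
open import Data.Nat.Properties using () renaming (_≟_ to _≟ℕ_)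
open import Data.Bool using (if_then_else_)
open import Data.List using (List; []; _∷_; length; take; map; upTo; deduplicate)
open import Data.Maybe using (Maybe; nothing; just)
open import Data.Maybe.Properties using (≡-dec)

data Tree : Set where
  node : List Tree → Tree

mutual
  size : Tree → ℕ
  size (node ts) = suc (sizes ts)

  sizes : List Tree → ℕ
  sizes []       = 0
  sizes (t ∷ ts) = size t + sizes ts

children : Tree → List Tree
children (node ts) = ts

-- Nodes among {root} ∪ {children of the root}:
-- nothing = the root r, just j = the j-th child (0-based, left to right) of r.
RootNbr : Set
RootNbr = Maybe ℕ

-- The child of the root joined to it by a heavy edge (2 * size v > size u),
-- scanning children with index offset k; the parent has size N.
heavyFrom : ℕ → ℕ → List Tree → RootNbr
heavyFrom N k []       = nothing
heavyFrom N k (t ∷ ts) = if N <ᵇ 2 * size t then just k else heavyFrom N (suc k) ts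

heavyAtRoot : Tree → RootNbr
heavyAtRoot (node cs) = heavyFrom (size (node cs)) 0 cs

-- S_{i+1} (i = 0 .. m-1): S with its rightmost i root-children (and subtrees)
-- removed, so S_1 = S, S_2 = S minus the last child, ..., S_m keeps only child 1.
-- Children of S_{i+1} are a prefix of those of S, so indices identify the same nodes.
stage : Tree → ℕ → Tree
stage (node cs) i = node (take (length cs ∸ i) cs)

zs : Tree → List RootNbr
zs S = map (λ i → heavyAtRoot (stage S i)) (upTo (length (children S)))

distinctZ : Tree → ℕ
distinctZ S = length (deduplicate (≡-dec _≟ℕ_) (zs S))

{-# OPTIONS --safe #-}
-- Read z_m, ..., z_1 in order of growing prefixes of the root's children. A value not seen
-- before is either the root, paid for by the size growing by at least one, or a heavy child
-- that was not the heavy child of the previous prefix; by uniqueness of heavy children it is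
-- then the newly added last child, so the size more than doubles. Hence 2 ^ #distinct is at
-- most the size of S, the root costing one unit of slack.
module Submission where

open import Defs
open import Data.Bool using (true; false; T)
open import Data.Empty using (⊥; ⊥-elim)
open import Data.List using (List; []; _∷_; _∷ʳ_; length; take; applyUpTo; applyDownFrom; deduplicate)
open import Data.List.Membership.Propositional using (_∈_; _∉_)
open import Data.List.Membership.Propositional.Properties using (∈-deduplicate⁺)
open import Data.List.Properties using (length-filter; filter-notAll; map-upTo; take-all)
import Data.List.Relation.Unary.Any as Any
open import Data.List.Relation.Unary.Any using (Any; here; there)
open import Data.Maybe using (nothing; just)
open import Data.Maybe.Properties using (≡-dec)
open import Data.Nat using (ℕ; zero; suc; _+_; _*_; _∸_; _^_; _≤_; _<_; _<ᵇ_; s≤s; z<s)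
open import Data.Nat.Logarithm using (⌊log₂_⌋; ⌊log₂⌋-mono-≤; ⌊log₂[2^n]⌋≡n)
open import Data.Nat.Properties
open import Data.Product using (∃; _×_; _,_; proj₁; proj₂)
open import Data.Sum using (_⊎_; inj₁; inj₂)
open import Data.Unit using (tt)
open import Function using (_∘_)
open import Relation.Binary.Definitions using (DecidableEquality)
open import Relation.Binary.PropositionalEquality
open import Relation.Nullary using (yes; no; ¬?)

module DistinctCount {a} {A : Set a} (_≟_ : DecidableEquality A) where

  open import Data.List.Membership.DecPropositional _≟_ using (_∈?_)

  #distinct : List A → ℕ
  #distinct xs = length (deduplicate _≟_ xs)

  #distinct-∷ : ∀ x xs → #distinct (x ∷ xs) ≤ suc (#distinct xs)
  #distinct-∷ x xs = s≤s (length-filter (¬? ∘ _≟_ x) (deduplicate _≟_ xs))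

  #distinct-∷-∈ : ∀ {x xs} → x ∈ xs → #distinct (x ∷ xs) ≤ #distinct xs
  #distinct-∷-∈ {x} {xs} x∈xs = filter-notAll (¬? ∘ _≟_ x) (deduplicate _≟_ xs)
    (Any.map (λ x≡y x≢y → x≢y x≡y) (∈-deduplicate⁺ _≟_ x∈xs))

  module _ (r : A) where

    -- Each distinct value other than r doubles q, whereas r only increments it: the second
    -- component is the slack reserved for r while it has not appeared.
    PowerBound : List A → ℕ → Set a
    PowerBound xs q = 2 ^ #distinct xs ≤ q × (r ∉ xs → 2 ^ suc (#distinct xs) ≤ suc q)

    powerBound-[] : PowerBound [] 1
    powerBound-[] = ≤-refl , λ _ → ≤-refl

    powerBound-∷-∈ : ∀ {x xs q q′} → x ∈ xs → q ≤ q′ → PowerBound xs q → PowerBound (x ∷ xs) q′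
    powerBound-∷-∈ x∈xs q≤q′ (bound , bound-r∉) =
        ≤-trans (^-monoʳ-≤ 2 (#distinct-∷-∈ x∈xs)) (≤-trans bound q≤q′)
      , λ r∉ → ≤-trans (^-monoʳ-≤ 2 (s≤s (#distinct-∷-∈ x∈xs)))
                       (≤-trans (bound-r∉ (r∉ ∘ there)) (s≤s q≤q′))

    powerBound-∷-root : ∀ {xs q q′} → q < q′ → PowerBound xs q → PowerBound (r ∷ xs) q′
    powerBound-∷-root {xs} q<q′ bound with r ∈? xs
    ... | yes r∈xs = powerBound-∷-∈ r∈xs (<⇒≤ q<q′) bound
    ... | no  r∉xs = ≤-trans (^-monoʳ-≤ 2 (#distinct-∷ r xs)) (≤-trans (proj₂ bound r∉xs) q<q′)
                   , λ r∉ → ⊥-elim (r∉ (here refl))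

    powerBound-∷-double : ∀ {x xs q q′} → 2 * q < q′ → PowerBound xs q → PowerBound (x ∷ xs) q′
    powerBound-∷-double {x} {xs} {q} 2q<q′ (bound , bound-r∉) =
        ≤-trans (^-monoʳ-≤ 2 (#distinct-∷ x xs)) (≤-trans (*-monoʳ-≤ 2 bound) (<⇒≤ 2q<q′))
      , λ r∉ → ≤-trans (^-monoʳ-≤ 2 (s≤s (#distinct-∷ x xs)))
                       (≤-trans (*-monoʳ-≤ 2 (bound-r∉ (r∉ ∘ there)))
                                (≤-trans (≤-reflexive (*-suc 2 q)) (s≤s 2q<q′)))

open DistinctCount (≡-dec _≟_)

2*n≡n+n : ∀ n → 2 * n ≡ n + n
2*n≡n+n n = cong (n +_) (+-identityʳ n)

m+n<2*n⇒2*m<m+n : ∀ {m n} → m + n < 2 * n → 2 * m < m + n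
m+n<2*n⇒2*m<m+n {m} {n} m+n<2n = begin-strict
  2 * m  ≡⟨ 2*n≡n+n m ⟩
  m + m  <⟨ +-monoʳ-< m (+-cancelʳ-< n m n (subst (m + n <_) (2*n≡n+n n) m+n<2n)) ⟩
  m + n  ∎
  where open ≤-Reasoning

sizes-∷ʳ : ∀ ts t → sizes (ts ∷ʳ t) ≡ sizes ts + size t
sizes-∷ʳ []       t = +-identityʳ (size t)
sizes-∷ʳ (u ∷ ts) t = trans (cong (size u +_) (sizes-∷ʳ ts t)) (sym (+-assoc (size u) (sizes ts) (size t)))

size-∷ʳ : ∀ ts t → size (node (ts ∷ʳ t)) ≡ size (node ts) + size t
size-∷ʳ ts t = cong suc (sizes-∷ʳ ts t)

size-∷ʳ-< : ∀ ts t → size (node ts) < size (node (ts ∷ʳ t))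
size-∷ʳ-< ts (node us) = subst (size (node ts) <_) (sym (size-∷ʳ ts (node us))) (m<m+n (size (node ts)) z<s)

Heavy : ℕ → Tree → Set
Heavy N t = N < 2 * size t

heavy-<ᵇ : ∀ {N} t → (N <ᵇ 2 * size t) ≡ true → Heavy N t
heavy-<ᵇ {N} t b = <ᵇ⇒< N (2 * size t) (subst T (sym b) tt)

light-<ᵇ : ∀ {N} t → (N <ᵇ 2 * size t) ≡ false → Heavy N t → ⊥
light-<ᵇ t b h = subst T b (<⇒<ᵇ h)

heavyFrom-just⇒heavy : ∀ {N k j} ts → heavyFrom N k ts ≡ just j → Any (Heavy N) ts
heavyFrom-just⇒heavy {N} (t ∷ ts) eq with N <ᵇ 2 * size t in b
... | true  = here (heavy-<ᵇ t b)
... | false = there (heavyFrom-just⇒heavy ts eq)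

heavy⇒<2*sizes : ∀ {N ts} → Any (Heavy N) ts → N < 2 * sizes ts
heavy⇒<2*sizes {ts = t ∷ ts} (here h)  = <-≤-trans h (*-monoʳ-≤ 2 (m≤m+n (size t) (sizes ts)))
heavy⇒<2*sizes {ts = t ∷ ts} (there h) = <-≤-trans (heavy⇒<2*sizes h) (*-monoʳ-≤ 2 (m≤n+m (sizes ts) (size t)))

heavy-unique : ∀ {N} t ts → sizes (t ∷ ts) < N → Heavy N t → Any (Heavy N) ts → ⊥
heavy-unique {N} t ts small heavy heavy′ = <-irrefl refl (begin-strict
  2 * N                      ≡⟨ 2*n≡n+n N ⟩
  N + N                      <⟨ +-mono-< heavy (heavy⇒<2*sizes heavy′) ⟩
  2 * size t + 2 * sizes ts  ≡⟨ *-distribˡ-+ 2 (size t) (sizes ts) ⟨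
  2 * sizes (t ∷ ts)         <⟨ *-monoʳ-< 2 small ⟩
  2 * N                      ∎)
  where open ≤-Reasoning

-- Passing from the threshold N′ of the larger tree to the smaller N keeps every heavy child
-- heavy, and by uniqueness it is still the one found first.
heavyFrom-∷ʳ : ∀ {N N′ j} k ps t → N ≤ N′ → sizes ps < N →
               heavyFrom N′ k (ps ∷ʳ t) ≡ just j → heavyFrom N k ps ≡ just j ⊎ Heavy N′ t
heavyFrom-∷ʳ {N′ = N′} k [] t _ _ eq with N′ <ᵇ 2 * size t in b
heavyFrom-∷ʳ k [] t _ _ eq  | true = inj₂ (heavy-<ᵇ t b)
heavyFrom-∷ʳ k [] t _ _ () | false
heavyFrom-∷ʳ {N} {N′} k (p ∷ ps) t N≤N′ small eq with N′ <ᵇ 2 * size p in b′ | N <ᵇ 2 * size p in b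
... | true  | true  = inj₁ eq
... | true  | false = ⊥-elim (light-<ᵇ p b (≤-<-trans N≤N′ (heavy-<ᵇ p b′)))
... | false | false = heavyFrom-∷ʳ (suc k) ps t N≤N′ (≤-<-trans (m≤n+m _ (size p)) small) eq
... | false | true with heavyFrom-∷ʳ (suc k) ps t N≤N′ (≤-<-trans (m≤n+m _ (size p)) small) eq
...   | inj₁ later = ⊥-elim (heavy-unique p ps small (heavy-<ᵇ p b) (heavyFrom-just⇒heavy ps later))
...   | inj₂ heavy = inj₂ heavy

heavyAtRoot-∷ʳ : ∀ ps t {j} → heavyAtRoot (node (ps ∷ʳ t)) ≡ just j →
                 heavyAtRoot (node ps) ≡ just j ⊎ 2 * size (node ps) < size (node (ps ∷ʳ t))
heavyAtRoot-∷ʳ ps t eq with heavyFrom-∷ʳ 0 ps t (<⇒≤ (size-∷ʳ-< ps t)) ≤-refl eq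
... | inj₁ earlier = inj₁ earlier
... | inj₂ heavy   = inj₂ (subst (λ N → 2 * size (node ps) < N) (sym (size-∷ʳ ps t))
                           (m+n<2*n⇒2*m<m+n {size (node ps)} (subst (_< 2 * size t) (size-∷ʳ ps t) heavy)))

powerBound-∷ʳ : ∀ ps t {xs} → (∀ {j} → heavyAtRoot (node ps) ≡ just j → just j ∈ xs) →
                PowerBound nothing xs (size (node ps)) →
                PowerBound nothing (heavyAtRoot (node (ps ∷ʳ t)) ∷ xs) (size (node (ps ∷ʳ t)))
powerBound-∷ʳ ps t recorded bound with heavyAtRoot (node (ps ∷ʳ t)) in eq
... | nothing = powerBound-∷-root nothing (size-∷ʳ-< ps t) bound
... | just j with heavyAtRoot-∷ʳ ps t eq
...   | inj₁ earlier  = powerBound-∷-∈ nothing (recorded earlier) (<⇒≤ (size-∷ʳ-< ps t)) bound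
...   | inj₂ doubling = powerBound-∷-double nothing doubling bound

take-suc-∷ʳ : ∀ {a} {A : Set a} k (xs : List A) → k < length xs → ∃ λ x → take (suc k) xs ≡ take k xs ∷ʳ x
take-suc-∷ʳ zero    (x ∷ xs) _         = x , refl
take-suc-∷ʳ (suc k) (x ∷ xs) (s≤s k<n) with y , eq ← take-suc-∷ʳ k xs k<n = y , cong (x ∷_) eq

applyUpTo-∸ : ∀ {a} {A : Set a} (f : ℕ → A) n → applyUpTo (λ i → f (n ∸ i)) n ≡ applyDownFrom (f ∘ suc) n
applyUpTo-∸ f zero    = refl
applyUpTo-∸ f (suc n) = cong (f (suc n) ∷_) (applyUpTo-∸ f n)

module Prefixes (cs : List Tree) where

  heavyAt : ℕ → RootNbr
  heavyAt k = heavyAtRoot (node (take k cs))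

  trace : ℕ → List RootNbr
  trace = applyDownFrom (heavyAt ∘ suc)

  heavyAt∈trace : ∀ k {j} → heavyAt k ≡ just j → just j ∈ trace k
  heavyAt∈trace zero    ()
  heavyAt∈trace (suc k) eq = here (sym eq)

  trace-powerBound : ∀ k → k ≤ length cs → PowerBound nothing (trace k) (size (node (take k cs)))
  trace-powerBound zero    _     = powerBound-[] nothing
  trace-powerBound (suc k) k<len with t , eq ← take-suc-∷ʳ k cs k<len =
    subst (λ ps → PowerBound nothing (heavyAtRoot (node ps) ∷ trace k) (size (node ps))) (sym eq)
      (powerBound-∷ʳ (take k cs) t (heavyAt∈trace k) (trace-powerBound k (<⇒≤ k<len)))

  zs≡trace : zs (node cs) ≡ trace (length cs)
  zs≡trace = trans (map-upTo _ (length cs)) (applyUpTo-∸ heavyAt (length cs))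

lemma9 : (n : ℕ) (S : Tree) → size S ≤ n → distinctZ S ≤ ⌊log₂ n ⌋
lemma9 n (node cs) size≤n = begin
  distinctZ (node cs)      ≡⟨ cong #distinct zs≡trace ⟩
  d                        ≡⟨ ⌊log₂[2^n]⌋≡n d ⟨
  ⌊log₂ 2 ^ d ⌋            ≤⟨ ⌊log₂⌋-mono-≤ (≤-trans (proj₁ (trace-powerBound m ≤-refl)) size-prefix≤n) ⟩
  ⌊log₂ n ⌋                ∎
  where
  open Prefixes cs
  open ≤-Reasoning
  m : ℕ
  m = length cs
  d : ℕ
  d = #distinct (trace m)
  size-prefix≤n : size (node (take m cs)) ≤ n
  size-prefix≤n = subst (λ ps → size (node ps) ≤ n) (sym (take-all m cs ≤-refl)) size≤n
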